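{- Fix $b\in\{0,1\}^{\mathbb{N}}$ and let $P(u,x,y):\equiv u_{n-1}<x\wedge((b_x=1\wedge x\le y)\to b_y=1)$ for $u=[u_0,\dots,u_{n-1}]\in\mathbb{N}^\ast$, $x,y\in\mathbb{N}$ (conjunct $u_{n-1}<x$ omitted for $u=[\,]$). Let $\mathcal{A}_\omega$ be the two-oracle algorithm defined as follows. States are $\langle\sigma,a\mid o_1,o_2\rangle$ with $\sigma\in(\{\mathsf{s},\mathsf{e}_1,\mathsf{e}_2\}\times\mathbb{N})^\ast$, $a\in\mathbb{N}^\ast$, $o_1,o_2\in\mathbb{N}\cup\{\Box\}$; the initial state is $\langle[(\mathsf{s},0)],[\,]\mid\Box,\Box\rangle$; $Q_1$ consists of states $\langle\sigma::(c,x),[\,]\mid\Box,\Box\rangle$ with $c\in\{\mathsf{s},\mathsf{e}_1\}$; $Q_2$ consists of states $\langle\sigma,[\,]\mid n,\Box\rangle$ with $n<|\sigma|$; end states are $\langle[\,],a\mid n,y\rangle$ with $n,y\in\mathbb{N}$; $\xi_\omega(\sigma,a):=\sigma_2::a::\mathbf{0}\in\mathbb{N}^{\mathbb{N}}$, where $\sigma_2\in\mathbb{N}^\ast$ is the sequence of second components of $\sigma$. Transitions: (a) $\langle\sigma::(c,x),[\,]\mid n,\Box\rangle\rhd_\omega\langle\sigma::(c,x)::(\mathsf{s},x+1),[\,]\mid\Box,\Box\rangle$; (b) $\langle\sigma::(\mathsf{e}_i,x),a\mid n,y\rangle\rhd_\omega\langle\sigma,x::a\mid n,y\rangle$ ($i=1,2$);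 (c) $\langle\sigma::(\mathsf{s},x),a\mid n,y\rangle\rhd_\omega\langle\sigma::(\mathsf{e}_1,y),[\,]\mid\Box,\Box\rangle$ if $b_x=1\wedge x\le y\wedge b_y=0$, and $\rhd_\omega\langle\sigma::(\mathsf{e}_2,x),a\mid n,y\rangle$ otherwise. With oracles $\phi_1,\phi_2:\mathbb{N}^{\mathbb{N}}\to\mathbb{N}$, a state $\langle\sigma,a\mid\Box,\Box\rangle\in Q_1$ moves to $\langle\sigma,a\mid\phi_1(\xi_\omega(\sigma,a)),\Box\rangle$, a state $\langle\sigma,a\mid n,\Box\rangle\in Q_2$ moves to $\langle\sigma,a\mid n,\phi_2(\xi_\omega(\sigma,a))\rangle$, and all other states move by $\rhd_\omega$. Then for all oracles $\phi_1,\phi_2$: if an end state $\langle[\,],a\mid n,y\rangle$ is reachable, then $P(\overline{\alpha}n,\alpha_n,y)$ holds for $\alpha:=a::\mathbf{0}$.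
   Context: $\mathbb{N}^\ast$ denotes finite sequences of naturals (similarly $Z^\ast$), $[\,]$ the empty sequence, $|\sigma|$ the length, $::$ extension/concatenation, $\mathbf{0}$ the constant zero sequence, and $\overline{\alpha}n:=[\alpha_0,\dots,\alpha_{n-1}]$. $\Box$ is a fresh symbol ("empty answer"). A state is reachable if there is a finite sequence of moves (as specified) from the initial state to it in which no state before the last is an end state. -}

module Defs where

open import Data.Nat using (ℕ; zero; suc; _≤_; _<_)
open import Data.Bool using (Bool; true; false)
open import Data.Maybe using (Maybe; just; nothing)
open import Data.List using (List; []; _∷_; _∷ʳ_; _++_; map; length; last; applyUpTo)
open import Data.Product using (_×_; _,_; proj₂)
open import Relation.Binary.PropositionalEquality using (_≡_)
open import Relation.Nullary using (¬_)

data Tag : Set where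
  s e₁ e₂ : Tag

-- Finite sequences are lists written left to right; σ :: (c , x) (extension
-- at the end) is  σ ∷ʳ (c , x).
-- The answer slots o₁ , o₂ ∈ ℕ ∪ {□} are  Maybe ℕ  with □ = nothing.
record State : Set where
  constructor ⟨_,_∣_,_⟩
  field
    σ  : List (Tag × ℕ)
    a  : List ℕ
    o₁ : Maybe ℕ
    o₂ : Maybe ℕ
open State public

-- u :: 0 :: 0 :: ...  as an element of ℕ^ℕ
ext0 : List ℕ → ℕ → ℕ
ext0 []       _       = 0
ext0 (u ∷ us) zero    = u
ext0 (u ∷ us) (suc n) = ext0 us n

initSeg : (ℕ → ℕ) → ℕ → List ℕ
initSeg α n = applyUpTo α n

ξ : List (Tag × ℕ) → List ℕ → ℕ → ℕ
ξ σ a = ext0 (map proj₂ σ ++ a)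

initial : State
initial = ⟨ (s , 0) ∷ [] , [] ∣ nothing , nothing ⟩

data Q₁ : State → Set where
  q₁s  : ∀ σ x → Q₁ ⟨ σ ∷ʳ (s , x) , [] ∣ nothing , nothing ⟩
  q₁e₁ : ∀ σ x → Q₁ ⟨ σ ∷ʳ (e₁ , x) , [] ∣ nothing , nothing ⟩

data Q₂ : State → Set where
  q₂ : ∀ σ n → n < length σ → Q₂ ⟨ σ , [] ∣ just n , nothing ⟩

data End : State → Set where
  end : ∀ a n y → End ⟨ [] , a ∣ just n , just y ⟩

module _ (b : ℕ → Bool) where

  Cond : ℕ → ℕ → Set
  Cond x y = (b x ≡ true) × (x ≤ y) × (b y ≡ false)

  data _▷_ : State → State → Set where
    ta  : ∀ σ c x n →
          ⟨ σ ∷ʳ (c , x) , [] ∣ just n , nothing ⟩ ▷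
          ⟨ σ ∷ʳ (c , x) ∷ʳ (s , suc x) , [] ∣ nothing , nothing ⟩
    tb₁ : ∀ σ x a n y →
          ⟨ σ ∷ʳ (e₁ , x) , a ∣ just n , just y ⟩ ▷ ⟨ σ , x ∷ a ∣ just n , just y ⟩
    tb₂ : ∀ σ x a n y →
          ⟨ σ ∷ʳ (e₂ , x) , a ∣ just n , just y ⟩ ▷ ⟨ σ , x ∷ a ∣ just n , just y ⟩
    tc₁ : ∀ σ x a n y → Cond x y →
          ⟨ σ ∷ʳ (s , x) , a ∣ just n , just y ⟩ ▷ ⟨ σ ∷ʳ (e₁ , y) , [] ∣ nothing , nothing ⟩
    tc₂ : ∀ σ x a n y → ¬ Cond x y →
          ⟨ σ ∷ʳ (s , x) , a ∣ just n , just y ⟩ ▷ ⟨ σ ∷ʳ (e₂ , x) , a ∣ just n , just y ⟩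

  module _ (φ₁ φ₂ : (ℕ → ℕ) → ℕ) where

    data Move : State → State → Set where
      m₁ : ∀ σ a → Q₁ ⟨ σ , a ∣ nothing , nothing ⟩ →
           Move ⟨ σ , a ∣ nothing , nothing ⟩ ⟨ σ , a ∣ just (φ₁ (ξ σ a)) , nothing ⟩
      m₂ : ∀ σ a n → Q₂ ⟨ σ , a ∣ just n , nothing ⟩ →
           Move ⟨ σ , a ∣ just n , nothing ⟩ ⟨ σ , a ∣ just n , just (φ₂ (ξ σ a)) ⟩
      m▷ : ∀ st st' → ¬ Q₁ st → ¬ Q₂ st → st ▷ st' → Move st st'

    data Reachable : State → Set where
      start : Reachable initial
      next  : ∀ {st st'} → Reachable st → ¬ End st → Move st st' → Reachable st'

  -- P(u,x,y) ≡ u_{n-1} < x ∧ ((b_x = 1 ∧ x ≤ y) → b_y = 1), first conjunct vacuous for u = []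
  P : List ℕ → ℕ → ℕ → Set
  P u x y = (∀ z → last u ≡ just z → z < x) × (b x ≡ true → x ≤ y → b y ≡ true)

module Submission where

-- Theorem 6.4 is a safety property of the algorithm A_ω, so it
-- is proved by an invariant of all reachable states.  Write the query list
-- of a state ⟨σ , a ∣ _ , _⟩ as  values σ a = σ₂ ++ a  (so ξ σ a = ext0 of
-- it).  In every reachable state
--   * the query list is strictly increasing;
--   * every stack entry (e₁ , x) records a point with b x = false, and
--     entries (e₂ , x) occur only on top of an answered state;
--   * once both answers n, y are present, n indexes into the query list and
--     no element z of a (nor an e₂ on top) refutes y, i.e. it is not the
--     case that b z = 1, z ≤ y and b y = 0.
-- The file first proves generic facts about increasing lists and about
-- ext0, then the algebra of query lists under pushing and popping, then
-- that every move preserves the invariant.  For an end state ⟨[] , a ∣ n , y⟩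
-- the query list is a itself, and the theorem reads off P from it.

open import Defs
open import Data.Nat using (ℕ; zero; suc; _≤_; _<_; s≤s)
open import Data.Nat.Properties using (<-≤-trans; n<1+n)
open import Data.Bool using (Bool; true; false)
open import Data.Bool.Properties using (¬-not; not-¬)
open import Data.List using (List; []; _∷_; _∷ʳ_; _++_; map; length; last; applyUpTo)
open import Data.List.Properties using (map-++; ++-assoc; ++-identityʳ; length-map; ∷ʳ-injective)
open import Data.List.Relation.Unary.All using (All; []; _∷_)
open import Data.List.Relation.Unary.All.Properties using (∷ʳ⁺; ∷ʳ⁻)
open import Data.List.Relation.Unary.Linked using (Linked; []; [-]; _∷_)
open import Data.Maybe using (just; nothing)
open import Data.Product using (_×_; _,_; proj₁; proj₂)
open import Data.Empty using (⊥)
open import Data.Unit using (⊤; tt)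
open import Level using (0ℓ)
open import Relation.Binary.Core using (Rel)
open import Relation.Nullary using (¬_)
open import Relation.Binary.PropositionalEquality
  using (_≡_; refl; sym; trans; cong; subst; module ≡-Reasoning)

Increasing : List ℕ → Set
Increasing = Linked _<_

linked-snoc : ∀ {A : Set} {R : Rel A 0ℓ} xs {x z} →
  Linked R (xs ++ x ∷ []) → R x z → Linked R (xs ++ x ∷ z ∷ [])
linked-snoc []           _          xRz = xRz ∷ [-]
linked-snoc (w ∷ [])     (wRx ∷ _)  xRz = wRx ∷ xRz ∷ [-]
linked-snoc (w ∷ v ∷ xs) (wRv ∷ rs) xRz = wRv ∷ linked-snoc (v ∷ xs) rs xRz

increasing-cut : ∀ xs {x y} ys →
  Increasing (xs ++ x ∷ ys) → x ≤ y → Increasing (xs ++ y ∷ [])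
increasing-cut []           _ _          _   = [-]
increasing-cut (w ∷ [])     _ (w<x ∷ _)  x≤y = <-≤-trans w<x x≤y ∷ [-]
increasing-cut (w ∷ v ∷ xs) ys (w<v ∷ rs) x≤y = w<v ∷ increasing-cut (v ∷ xs) ys rs x≤y

ext0-increasing : ∀ l m → Increasing l → suc m < length l → ext0 l m < ext0 l (suc m)
ext0-increasing (x ∷ y ∷ l) zero    (x<y ∷ _)  _           = x<y
ext0-increasing (x ∷ y ∷ l) (suc m) (_ ∷ inc)  (s≤s m<len) = ext0-increasing (y ∷ l) m inc m<len
ext0-increasing (x ∷ [])    m       [-]        (s≤s ())

ext0-all : ∀ {Q : ℕ → Set} l n → All Q l → n < length l → Q (ext0 l n)
ext0-all (x ∷ l) zero    (qx ∷ _)  _           = qx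
ext0-all (x ∷ l) (suc n) (_ ∷ ql)  (s≤s n<len) = ext0-all l n ql n<len

last-applyUpTo : ∀ (f : ℕ → ℕ) m → last (applyUpTo f (suc m)) ≡ just (f m)
last-applyUpTo f zero    = refl
last-applyUpTo f (suc m) = last-applyUpTo (λ k → f (suc k)) m

values : List (Tag × ℕ) → List ℕ → List ℕ
values σ a = map proj₂ σ ++ a

-- Popping the top entry (c , x) of the stack onto the answer list does not
-- change the query list; this is why (b) and the retagging in (c) preserve
-- every property of it.
values-pop : ∀ σ c x a → values (σ ∷ʳ (c , x)) a ≡ values σ (x ∷ a)
values-pop σ c x a = begin
  map proj₂ (σ ++ (c , x) ∷ []) ++ a  ≡⟨ cong (_++ a) (map-++ proj₂ σ ((c , x) ∷ [])) ⟩
  (map proj₂ σ ++ x ∷ []) ++ a        ≡⟨ ++-assoc (map proj₂ σ) (x ∷ []) a ⟩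
  map proj₂ σ ++ x ∷ a                ∎
  where open ≡-Reasoning

values-retag : ∀ σ c c′ x a → values (σ ∷ʳ (c , x)) a ≡ values (σ ∷ʳ (c′ , x)) a
values-retag σ c c′ x a = trans (values-pop σ c x a) (sym (values-pop σ c′ x a))

length-values : ∀ σ → length (values σ []) ≡ length σ
length-values σ = trans (cong length (++-identityʳ (map proj₂ σ))) (length-map proj₂ σ)

-- Properties of the query list that are kept once both answers are known.
Indexed : ℕ → List ℕ → Set
Indexed n w = Increasing w × n < length w

initSeg-below : ∀ a n → Indexed n a →
  ∀ z → last (initSeg (ext0 a) n) ≡ just z → z < ext0 a n
initSeg-below a zero    _               z ()
initSeg-below a (suc m) (inc , m+1<len) z last≡z
  with trans (sym (last-applyUpTo (ext0 a) m)) last≡z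
... | refl = ext0-increasing a m inc m+1<len

module _ (b : ℕ → Bool) where

  Consistent : ℕ → ℕ → Set
  Consistent y z = ¬ Cond b z y

  false⇒consistent : ∀ {y z} → b z ≡ false → Consistent y z
  false⇒consistent bz≡false (bz≡true , _) = not-¬ bz≡false bz≡true

  Admissible : Tag × ℕ → Set
  Admissible (s  , x) = ⊤
  Admissible (e₁ , x) = b x ≡ false
  Admissible (e₂ , x) = ⊥

  Top : ℕ → Tag × ℕ → Set
  Top y (s  , x) = ⊤
  Top y (e₁ , x) = b x ≡ false
  Top y (e₂ , x) = Consistent y x

  admissible⇒top : ∀ {y} p → Admissible p → Top y p
  admissible⇒top (s  , x) adm = adm
  admissible⇒top (e₁ , x) adm = adm

  data Stack (y : ℕ) : List (Tag × ℕ) → Set where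
    clean   : ∀ {σ} → All Admissible σ → Stack y σ
    exiting : ∀ {σ x} → All Admissible σ → Consistent y x → Stack y (σ ∷ʳ (e₂ , x))

  -- Below the top every entry of an answered stack is admissible.  The
  -- equation argument lets the e₂-case be inspected via ∷ʳ-injectivity.
  stack-pop : ∀ {y τ} σ p → Stack y τ → τ ≡ σ ∷ʳ p → All Admissible σ × Top y p
  stack-pop σ p (clean adm) refl with ∷ʳ⁻ adm
  ... | adm-σ , adm-p = adm-σ , admissible⇒top p adm-p
  stack-pop σ p (exiting {σ′} adm con) eq with ∷ʳ-injective σ′ σ eq
  ... | refl , refl = adm , con

  Inv : State → Set
  Inv ⟨ σ , a ∣ _      , nothing ⟩ = All Admissible σ × Increasing (values σ a)
  Inv ⟨ σ , a ∣ nothing , just y ⟩ = ⊥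
  Inv ⟨ σ , a ∣ just n , just y  ⟩ = Stack y σ × All (Consistent y) a × Indexed n (values σ a)

  push-increasing : ∀ σ c x → Increasing (values (σ ∷ʳ (c , x)) []) →
    Increasing (values (σ ∷ʳ (c , x) ∷ʳ (s , suc x)) [])
  push-increasing σ c x inc =
    subst Increasing (sym pushed) (linked-snoc (map proj₂ σ) popped (n<1+n x))
    where
      popped : Increasing (values σ (x ∷ []))
      popped = subst Increasing (values-pop σ c x []) inc
      pushed : values (σ ∷ʳ (c , x) ∷ʳ (s , suc x)) [] ≡ values σ (x ∷ suc x ∷ [])
      pushed = trans (values-pop (σ ∷ʳ (c , x)) s (suc x) []) (values-pop σ c x (suc x ∷ []))

  refute-increasing : ∀ σ x y a → x ≤ y → Increasing (values (σ ∷ʳ (s , x)) a) →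
    Increasing (values (σ ∷ʳ (e₁ , y)) [])
  refute-increasing σ x y a x≤y inc =
    subst Increasing (sym (values-pop σ e₁ y []))
      (increasing-cut (map proj₂ σ) a (subst Increasing (values-pop σ s x a) inc) x≤y)

  step-▷ : ∀ {st st′} → Inv st → _▷_ b st st′ → Inv st′
  step-▷ (adm , inc) (ta σ c x n) = ∷ʳ⁺ adm tt , push-increasing σ c x inc
  step-▷ (stk , con , idx) (tb₁ σ x a n y) with stack-pop σ (e₁ , x) stk refl
  ... | adm , bx≡false =
    clean adm , false⇒consistent bx≡false ∷ con , subst (Indexed n) (values-pop σ e₁ x a) idx
  step-▷ (stk , con , idx) (tb₂ σ x a n y) with stack-pop σ (e₂ , x) stk refl
  ... | adm , con-x = clean adm , con-x ∷ con , subst (Indexed n) (values-pop σ e₂ x a) idx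
  step-▷ (stk , con , (inc , _)) (tc₁ σ x a n y (_ , x≤y , by≡false)) =
    ∷ʳ⁺ (proj₁ (stack-pop σ (s , x) stk refl)) by≡false , refute-increasing σ x y a x≤y inc
  step-▷ (stk , con , idx) (tc₂ σ x a n y ¬cond) =
    exiting (proj₁ (stack-pop σ (s , x) stk refl)) ¬cond , con ,
    subst (Indexed n) (values-retag σ s e₂ x a) idx

  module _ (φ₁ φ₂ : (ℕ → ℕ) → ℕ) where

    step : ∀ {st st′} → Inv st → Move b φ₁ φ₂ st st′ → Inv st′
    step inv         (m₁ σ a _)                  = inv
    step (adm , inc) (m₂ σ a n (q₂ σ n n<len))   =
      clean adm , [] , inc , subst (n <_) (sym (length-values σ)) n<len
    step inv         (m▷ _ _ _ _ t)              = step-▷ inv t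

    reachable⇒inv : ∀ {st} → Reachable b φ₁ φ₂ st → Inv st
    reachable⇒inv start            = tt ∷ [] , [-]
    reachable⇒inv (next r _ move)  = step (reachable⇒inv r) move

  consistent⇒answer : ∀ {x y} → Consistent y x → b x ≡ true → x ≤ y → b y ≡ true
  consistent⇒answer con bx≡true x≤y = ¬-not (λ by≡false → con (bx≡true , x≤y , by≡false))

theorem6p4 : (b : ℕ → Bool) (φ₁ φ₂ : (ℕ → ℕ) → ℕ) (a : List ℕ) (n y : ℕ) →
    Reachable b φ₁ φ₂ ⟨ [] , a ∣ just n , just y ⟩ →
    P b (initSeg (ext0 a) n) (ext0 a n) y
theorem6p4 b φ₁ φ₂ a n y r with reachable⇒inv b φ₁ φ₂ r
... | _ , con , idx@(_ , n<len) =
  initSeg-below a n idx , consistent⇒answer b (ext0-all a n con n<len)
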